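{- Let $t>1$ be an integer and let $A$ be a connected generalized $t$-nicely edge distance-balanced graph with constant $\gamma'_A$ and diameter $d$. Then $d-1\le t\gamma'_A$.
   Context: All graphs are finite, connected and undirected, with shortest-path distance $d_A$. For a vertex $x$ and an edge $f'=x'y'$, $d_A(x,f')=\min\{d_A(x,x'),d_A(x,y')\}$. For an edge $f=\alpha\beta$, $m_\alpha^A(f)=|\{f'\in E(A): d_A(\alpha,f')<d_A(\beta,f')\}|$, and $m_\beta^A(f)$ symmetrically. For an integer $t>1$, $A$ is generalized $t$-nicely edge distance-balanced if there is a positive integer $\gamma'_A$ such that every edge $f$ has its endpoints labelled $\alpha,\beta$ with $m_\beta^A(f)=\gamma'_A$ and $m_\alpha^A(f)=t\gamma'_A$. -}

module Defs where

open import Data.Nat using (ℕ; zero; suc; _+_; _*_; _≤_; _<_; _<?_; _⊓_)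
open import Data.Nat.Properties using (_≟_)
open import Data.Bool using (Bool; true; false)
open import Data.Fin using (Fin; toℕ)
open import Data.List using (List; length; filter; concatMap; map; allFin)
open import Data.Product using (Σ; _×_; _,_; ∃-syntax)
open import Data.Sum using (_⊎_)
open import Relation.Binary.PropositionalEquality using (_≡_)
open import Relation.Nullary using (¬_)
open import Relation.Nullary.Decidable using (_×-dec_)
open import Data.Bool.Properties using () renaming (_≟_ to _≟ᵇ_)

record Graph (n : ℕ) : Set where
  field
    adj   : Fin n → Fin n → Bool
    sym   : ∀ x y → adj x y ≡ adj y x
    irref : ∀ x → adj x x ≡ false

open Graph public

data Walk {n : ℕ} (A : Graph n) : Fin n → Fin n → Set where
  [] : ∀ {x} → Walk A x x
  _∷_ : ∀ {x y z} → adj A x y ≡ true → Walk A y z → Walk A x z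

walkLength : ∀ {n} {A : Graph n} {x y} → Walk A x y → ℕ
walkLength [] = zero
walkLength (_ ∷ w) = suc (walkLength w)

-- d is the shortest-path distance of A: d x y is the length of some walk
-- from x to y and no walk from x to y is shorter.  (This determines d
-- uniquely, and its existence for all x y says A is connected.)
IsShortestPathDistance : ∀ {n} → Graph n → (Fin n → Fin n → ℕ) → Set
IsShortestPathDistance A d =
  ∀ x y → (Σ (Walk A x y) λ w → walkLength w ≡ d x y)
        × (∀ (w : Walk A x y) → d x y ≤ walkLength w)

-- The edge set E(A): each edge x'y' listed once as the pair (x', y') with
-- toℕ x' < toℕ y'.
edges : ∀ {n} → Graph n → List (Fin n × Fin n)
edges {n} A =
  filter (λ p → (toℕ (Data.Product.proj₁ p) <? toℕ (Data.Product.proj₂ p))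
                 ×-dec (adj A (Data.Product.proj₁ p) (Data.Product.proj₂ p) ≟ᵇ true))
         (concatMap (λ x → map (λ y → (x , y)) (allFin n)) (allFin n))

distToEdge : ∀ {n} → (Fin n → Fin n → ℕ) → Fin n → Fin n × Fin n → ℕ
distToEdge d x (x' , y') = d x x' ⊓ d x y'

-- m_a(f) for the edge f = ab: number of edges strictly closer to a than to b.
m : ∀ {n} → Graph n → (Fin n → Fin n → ℕ) → Fin n → Fin n → ℕ
m A d a b = length (filter (λ f → distToEdge d a f <? distToEdge d b f) (edges A))

IsGenNicelyEDB : ∀ {n} → Graph n → (Fin n → Fin n → ℕ) → ℕ → ℕ → Set
IsGenNicelyEDB A d t γ =
  0 < γ ×
  (∀ x y → adj A x y ≡ true →
     (m A d y x ≡ γ × m A d x y ≡ t * γ) ⊎ (m A d x y ≡ γ × m A d y x ≡ t * γ))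

IsDiameter : ∀ {n} → (Fin n → Fin n → ℕ) → ℕ → Set
IsDiameter {n} d D = (∀ x y → d x y ≤ D) × (∃[ x ] ∃[ y ] d x y ≡ D)

-- Let d(x,y) = D, and let x u … y be a shortest path, so the path from u to y
-- has length D - 1.  Along it every vertex z_j satisfies d(u,z_j) = j and
-- d(x,z_j) = j + 1, so its j-th edge is at distance j from u and j + 1 from x.
-- These D - 1 edges are all counted by m_u(xu), and they are distinct since
-- their distances from u are.  Balancedness bounds m_u(xu) by t γ'.
module Submission where

open import Defs hiding (sym)
open import Data.Nat using (ℕ; zero; suc; _+_; _*_; _≤_; _<_; _⊓_; _<?_; z≤n; s≤s)
open import Data.Nat.Properties
open import Data.Fin using (Fin; toℕ)
open import Data.Fin.Properties using (toℕ-injective; toℕ<n; injective⇒≤)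
open import Data.Bool using (true)
open import Data.List using (List; length; filter; lookup)
open import Data.List.Membership.Propositional using (_∈_; lose)
open import Data.List.Membership.Propositional.Properties using (∈-filter⁺; ∈-concatMap⁺; ∈-map⁺; ∈-allFin)
open import Data.List.Relation.Unary.Any as Any using (Any)
open import Data.List.Relation.Unary.Any.Properties using (lookup-index)
open import Data.Product using (Σ; _×_; _,_; proj₁; proj₂)
open import Data.Sum using (inj₁; inj₂)
open import Relation.Binary.PropositionalEquality
open import Relation.Binary using (tri<; tri≈; tri>)
open import Relation.Nullary using (contradiction)

values-below⇒≤-length : ∀ {a} {X : Set a} (h : X → ℕ) (xs : List X) N →
                         (∀ k → k < N → Any (λ x → h x ≡ k) xs) → N ≤ length xs
values-below⇒≤-length h xs N attained = injective⇒≤ index-injective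
  where
  index : Fin N → Fin (length xs)
  index i = Any.index (attained (toℕ i) (toℕ<n i))

  index-injective : ∀ {i j} → index i ≡ index j → i ≡ j
  index-injective {i} {j} eq = toℕ-injective (begin
    toℕ i                     ≡⟨ sym (lookup-index (attained (toℕ i) (toℕ<n i))) ⟩
    h (lookup xs (index i))   ≡⟨ cong (λ p → h (lookup xs p)) eq ⟩
    h (lookup xs (index j))   ≡⟨ lookup-index (attained (toℕ j) (toℕ<n j)) ⟩
    toℕ j                     ∎)
    where open ≡-Reasoning

_++ʷ_ : ∀ {n} {A : Graph n} {a b c} → Walk A a b → Walk A b c → Walk A a c
[] ++ʷ v = v
(e ∷ w) ++ʷ v = e ∷ (w ++ʷ v)

length-++ʷ : ∀ {n} {A : Graph n} {a b c} (w : Walk A a b) (v : Walk A b c) →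
             walkLength (w ++ʷ v) ≡ walkLength w + walkLength v
length-++ʷ [] v = refl
length-++ʷ (e ∷ w) v = cong suc (length-++ʷ w v)

ordered-edge∈edges : ∀ {n} (A : Graph n) {a b} → toℕ a < toℕ b → adj A a b ≡ true →
                     (a , b) ∈ edges A
ordered-edge∈edges A {a} {b} a<b a~b =
  ∈-filter⁺ _ (∈-concatMap⁺ _ (Any.map (λ { refl → ∈-map⁺ _ (∈-allFin b) }) (∈-allFin a))) (a<b , a~b)

edge-listed : ∀ {n} (A : Graph n) (d : Fin n → Fin n → ℕ) {a b} → adj A a b ≡ true →
              Σ (Fin n × Fin n) λ f → f ∈ edges A × (∀ u → distToEdge d u f ≡ d u a ⊓ d u b)
edge-listed A d {a} {b} a~b with <-cmp (toℕ a) (toℕ b)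
... | tri< a<b _ _ = (a , b) , ordered-edge∈edges A a<b a~b , λ _ → refl
... | tri> _ _ b<a =
  (b , a) , ordered-edge∈edges A b<a (trans (Graph.sym A b a) a~b) , λ u → ⊓-comm (d u b) (d u a)
... | tri≈ _ a≡b _ with toℕ-injective a≡b
...   | refl = contradiction (trans (sym a~b) (irref A a)) λ ()

module ShortestPaths {n} (A : Graph n) (d : Fin n → Fin n → ℕ) (sp : IsShortestPathDistance A d) where

  d-triangle : ∀ a b c → d a c ≤ d a b + d b c
  d-triangle a b c with sp a b | sp b c
  ... | (w , |w|≡dab) , _ | (v , |v|≡dbc) , _ =
    subst (d a c ≤_) (trans (length-++ʷ w v) (cong₂ _+_ |w|≡dab |v|≡dbc)) (proj₂ (sp a c) (w ++ʷ v))

  d-adj≤1 : ∀ {a b} → adj A a b ≡ true → d a b ≤ 1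
  d-adj≤1 a~b = proj₂ (sp _ _) (a~b ∷ [])

  d-step : ∀ u {a b} → adj A a b ≡ true → d u b ≤ suc (d u a)
  d-step u {a} {b} a~b = begin
    d u b         ≤⟨ d-triangle u a b ⟩
    d u a + d a b ≤⟨ +-monoʳ-≤ (d u a) (d-adj≤1 a~b) ⟩
    d u a + 1     ≡⟨ +-comm (d u a) 1 ⟩
    suc (d u a)   ∎
    where open ≤-Reasoning

  closerEdges : Fin n → Fin n → List (Fin n × Fin n)
  closerEdges a b = filter (λ f → distToEdge d a f <? distToEdge d b f) (edges A)

  -- s is the part from z on of a shortest path x u … y, and z is its vertex at
  -- position j after u.
  module Geodesic {x u y : Fin n} (x~u : adj A x u ≡ true) where

    levels : ∀ {z} (s : Walk A z y) j → d u z ≤ j → d x y ≡ suc (j + walkLength s) →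
             d u z ≡ j × d x z ≡ suc j
    levels {z} s j duz≤j dxy≡ = ≤-antisym duz≤j j≤duz , ≤-antisym dxz≤1+j 1+j≤dxz
      where
      dxz≤1+duz : d x z ≤ suc (d u z)
      dxz≤1+duz = ≤-trans (d-triangle x u z) (+-monoˡ-≤ (d u z) (d-adj≤1 x~u))

      dxz≤1+j : d x z ≤ suc j
      dxz≤1+j = ≤-trans dxz≤1+duz (s≤s duz≤j)

      1+j≤dxz : suc j ≤ d x z
      1+j≤dxz = +-cancelʳ-≤ (walkLength s) (suc j) (d x z) (begin
        suc j + walkLength s   ≡⟨ sym dxy≡ ⟩
        d x y                  ≤⟨ d-triangle x z y ⟩
        d x z + d z y          ≤⟨ +-monoʳ-≤ (d x z) (proj₂ (sp z y) s) ⟩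
        d x z + walkLength s   ∎)
        where open ≤-Reasoning

      j≤duz : j ≤ d u z
      j≤duz = ≤-pred (≤-trans 1+j≤dxz dxz≤1+duz)

    closer-edges-at-levels : ∀ {z} (s : Walk A z y) j → d u z ≤ j → d x y ≡ suc (j + walkLength s) →
                             ∀ k → k < walkLength s →
                             Any (λ f → distToEdge d u f ≡ j + k) (closerEdges u x)
    closer-edges-at-levels (z~z' ∷ s) j duz≤j dxy≡ zero _ =
      lose (∈-filter⁺ _ (proj₁ (proj₂ listed)) (subst₂ _<_ (sym duf≡j) (sym dxf≡1+j) (n<1+n j)))
           (trans duf≡j (sym (+-identityʳ j)))
      where
      listed = edge-listed A d z~z'
      f = proj₁ listed
      atz  = levels (z~z' ∷ s) j duz≤j dxy≡
      atz' = levels s (suc j) (≤-trans (d-step u z~z') (s≤s duz≤j)) (trans dxy≡ (cong suc (+-suc j _)))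

      duf≡j : distToEdge d u f ≡ j
      duf≡j = trans (proj₂ (proj₂ listed) u)
                    (trans (cong₂ _⊓_ (proj₁ atz) (proj₁ atz')) (m≤n⇒m⊓n≡m (n≤1+n j)))

      dxf≡1+j : distToEdge d x f ≡ suc j
      dxf≡1+j = trans (proj₂ (proj₂ listed) x)
                      (trans (cong₂ _⊓_ (proj₂ atz) (proj₂ atz')) (m≤n⇒m⊓n≡m (n≤1+n (suc j))))
    closer-edges-at-levels (z~z' ∷ s) j duz≤j dxy≡ (suc k) (s≤s k<|s|) =
      Any.map (λ duf≡ → trans duf≡ (sym (+-suc j k)))
        (closer-edges-at-levels s (suc j) (≤-trans (d-step u z~z') (s≤s duz≤j))
                                (trans dxy≡ (cong suc (+-suc j _))) k k<|s|)

    path-length≤m : (w : Walk A u y) → d x y ≡ suc (walkLength w) → walkLength w ≤ m A d u x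
    path-length≤m w dxy≡ =
      values-below⇒≤-length (distToEdge d u) (closerEdges u x) (walkLength w)
        (closer-edges-at-levels w 0 (proj₂ (sp u u) []) dxy≡)

m≤t*γ : ∀ {n} {A : Graph n} {d : Fin n → Fin n → ℕ} {t γ} → 1 ≤ t → IsGenNicelyEDB A d t γ →
        ∀ {a b} → adj A a b ≡ true → m A d a b ≤ t * γ
m≤t*γ {t = suc t'} {γ} _ (_ , balanced) {a} {b} a~b with balanced a b a~b
... | inj₁ (_ , mab≡tγ) = ≤-reflexive mab≡tγ
... | inj₂ (mab≡γ , _) = ≤-trans (≤-reflexive mab≡γ) (m≤n*m γ (suc t'))

lemma4p2 : (n : ℕ) (A : Graph n) (d : Fin n → Fin n → ℕ)
           (t γ D : ℕ) → 1 < t →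
           IsShortestPathDistance A d →
           IsGenNicelyEDB A d t γ →
           IsDiameter d D →
           D ≤ suc (t * γ)
lemma4p2 n A d t γ D 1<t sp edb (_ , x , y , dxy≡D) with proj₁ (sp x y)
... | [] , 0≡dxy = subst (_≤ suc (t * γ)) (trans 0≡dxy dxy≡D) z≤n
... | _∷_ {y = u} x~u w , |w|+1≡dxy =
  subst (_≤ suc (t * γ)) (trans |w|+1≡dxy dxy≡D) (s≤s (begin
  walkLength w ≤⟨ ShortestPaths.Geodesic.path-length≤m A d sp x~u w (sym |w|+1≡dxy) ⟩
  m A d u x    ≤⟨ m≤t*γ {A = A} {d} (<⇒≤ 1<t) edb (trans (Graph.sym A u x) x~u) ⟩
  t * γ        ∎))
  where open ≤-Reasoning
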